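{- For each of the following groups $G$ of order $24$ there exists a $(G,[1,1,1,2,2,17],12)$ Hadamard partitioned difference family: (a) $C_3\rtimes C_8=\langle a,b \mid a^8=b^3=1,\ ab^{ -1}=ba\rangle$; (b) $SL(2,3)$, the group of $2\times 2$ matrices over $\mathbb{Z}_3$ with determinant $1$; (c) $\mathbb{Z}_3\times D_8$, where $D_8=\langle x,y\mid x^4=1,\ y^2=1,\ yx^i=x^{ -i}y\rangle$ is the dihedral group of order $8$.
   Context: For a subset $B$ of a group $G$, the list of differences $\Delta B$ is the multiset $\{xy^{ -1}: x,y\in B,\ x\neq y\}$ (in additive notation, $x-y$). A $(G,[k_1,\dots,k_t],\lambda)$ partitioned difference family is a partition of $G$ into blocks $B_1,\dots,B_t$ with $|B_i|=k_i$ such that the multiset union of the $\Delta B_i$ covers every non-identity element of $G$ exactly $\lambda$ times; it is Hadamard if $|G|=2\lambda$. Here $[1,1,1,2,2,17]$ means three blocks of size $1$, two of size $2$ and one of size $17$. -}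

module Defs where

open import Data.Nat using (ℕ; _+_; _*_; _∸_)
open import Data.Nat.DivMod using (_mod_)
open import Data.Fin using (Fin; toℕ)
open import Data.Fin.Properties renaming (_≟_ to _≟ᶠ_)
open import Data.Product using (_×_; _,_)
open import Data.Product.Properties using (≡-dec)
open import Data.List using (List; []; _∷_; [_]; map; length; filter; concat; concatMap; allFin; cartesianProduct)
open import Data.List.Relation.Binary.Permutation.Propositional using (_↭_)
open import Data.Bool using (if_then_else_)
open import Relation.Nullary using (¬_; does)
open import Relation.Binary.PropositionalEquality using (_≡_)
open import Relation.Binary.Definitions using (DecidableEquality)

-- A finite group presented concretely: an ambient type with decidable
-- equality, a multiplication, an inverse, an identity, and the list of
-- the elements of G (each element listed exactly once).

record FinGroup : Set₁ where
  field
    Carrier : Set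
    _≟_     : DecidableEquality Carrier
    _·_     : Carrier → Carrier → Carrier
    _⁻¹     : Carrier → Carrier
    e       : Carrier
    elems   : List Carrier

module _ (G : FinGroup) where
  open FinGroup G

  Δ : List Carrier → List Carrier
  Δ B = concatMap (λ x → concatMap (λ y →
          if does (x ≟ y) then [] else [ x · (y ⁻¹) ]) B) B

  mult : Carrier → List Carrier → ℕ
  mult g xs = length (filter (λ z → z ≟ g) xs)

  IsPDF : List (List Carrier) → List ℕ → ℕ → Set
  IsPDF blocks ks lam =
      (map length blocks ≡ ks)
    × (concat blocks ↭ elems)
    × (∀ g → g Data.List.Membership.Propositional.∈ elems → ¬ (g ≡ e) →
         mult g (concatMap Δ blocks) ≡ lam)
    where import Data.List.Membership.Propositional

  IsHadamardPDF : List (List Carrier) → List ℕ → ℕ → Set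
  IsHadamardPDF blocks ks lam = IsPDF blocks ks lam × (length elems ≡ 2 * lam)

_⊕₃_ : Fin 3 → Fin 3 → Fin 3
x ⊕₃ y = (toℕ x + toℕ y) mod 3
_⊗₃_ : Fin 3 → Fin 3 → Fin 3
x ⊗₃ y = (toℕ x * toℕ y) mod 3
neg₃ : Fin 3 → Fin 3
neg₃ x = (3 ∸ toℕ x) mod 3

_⊕₈_ : Fin 8 → Fin 8 → Fin 8
x ⊕₈ y = (toℕ x + toℕ y) mod 8
neg₈ : Fin 8 → Fin 8
neg₈ x = (8 ∸ toℕ x) mod 8

_⊕₄_ : Fin 4 → Fin 4 → Fin 4
x ⊕₄ y = (toℕ x + toℕ y) mod 4
neg₄ : Fin 4 → Fin 4
neg₄ x = (4 ∸ toℕ x) mod 4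

_⊕₂_ : Fin 2 → Fin 2 → Fin 2
x ⊕₂ y = (toℕ x + toℕ y) mod 2

-- (a) C₃ ⋊ C₈ = ⟨a, b | a⁸ = b³ = 1, a b⁻¹ = b a⟩.
-- The relation gives a b a⁻¹ = b⁻¹, so every element is uniquely
-- b^j a^i (j ∈ ℤ₃, i ∈ ℤ₈), represented by the pair (j , i), with
-- (b^j a^i)(b^k a^l) = b^(j + (-1)^i k) a^(i + l).

sign₃ : Fin 8 → Fin 3 → Fin 3
sign₃ i k = if does ((toℕ i mod 2) ≟ᶠ Data.Fin.zero) then k else neg₃ k

C3⋊C8 : FinGroup
C3⋊C8 = record
  { Carrier = Fin 3 × Fin 8
  ; _≟_     = ≡-dec _≟ᶠ_ _≟ᶠ_
  ; _·_     = λ { (j , i) (k , l) → (j ⊕₃ sign₃ i k , i ⊕₈ l) }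
  ; _⁻¹     = λ { (j , i) → (neg₃ (sign₃ (neg₈ i) j) , neg₈ i) }
  ; e       = (Data.Fin.zero , Data.Fin.zero)
  ; elems   = cartesianProduct (allFin 3) (allFin 8)
  }

-- (b) SL(2,3): 2×2 matrices (p q / r s) over ℤ₃ with determinant 1,
-- under matrix multiplication.  Inverse of a determinant-1 matrix is
-- its adjugate (s −q / −r p).

M₂ : Set
M₂ = Fin 3 × Fin 3 × Fin 3 × Fin 3

det : M₂ → Fin 3
det (p , q , r , s) = (p ⊗₃ s) ⊕₃ neg₃ (q ⊗₃ r)

_≟M_ : DecidableEquality M₂
_≟M_ = ≡-dec _≟ᶠ_ (≡-dec _≟ᶠ_ (≡-dec _≟ᶠ_ _≟ᶠ_))

allM₂ : List M₂
allM₂ = concatMap (λ p → concatMap (λ q → concatMap (λ r → map (λ s → (p , q , r , s))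
          (allFin 3)) (allFin 3)) (allFin 3)) (allFin 3)

SL23 : FinGroup
SL23 = record
  { Carrier = M₂
  ; _≟_     = _≟M_
  ; _·_     = λ { (p , q , r , s) (p' , q' , r' , s') →
                  ( (p ⊗₃ p') ⊕₃ (q ⊗₃ r') , (p ⊗₃ q') ⊕₃ (q ⊗₃ s')
                  , (r ⊗₃ p') ⊕₃ (s ⊗₃ r') , (r ⊗₃ q') ⊕₃ (s ⊗₃ s') ) }
  ; _⁻¹     = λ { (p , q , r , s) → (s , neg₃ q , neg₃ r , p) }
  ; e       = (Data.Fin.suc Data.Fin.zero , Data.Fin.zero , Data.Fin.zero , Data.Fin.suc Data.Fin.zero)
  ; elems   = filter (λ m → det m ≟ᶠ Data.Fin.suc Data.Fin.zero) allM₂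
  }

-- (c) ℤ₃ × D₈, D₈ = ⟨x, y | x⁴ = 1, y² = 1, y xⁱ = x⁻ⁱ y⟩.
-- Elements of D₈ are uniquely x^i y^s (i ∈ ℤ₄, s ∈ ℤ₂), represented by
-- (i , s), with (x^i y^s)(x^k y^t) = x^(i + (-1)^s k) y^(s + t).

sign₄ : Fin 2 → Fin 4 → Fin 4
sign₄ s k = if does (s ≟ᶠ Data.Fin.zero) then k else neg₄ k

Z3×D8 : FinGroup
Z3×D8 = record
  { Carrier = Fin 3 × (Fin 4 × Fin 2)
  ; _≟_     = ≡-dec _≟ᶠ_ (≡-dec _≟ᶠ_ _≟ᶠ_)
  ; _·_     = λ { (u , (i , s)) (v , (k , t)) → (u ⊕₃ v , (i ⊕₄ sign₄ s k , s ⊕₂ t)) }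
  ; _⁻¹     = λ { (u , (i , s)) → (neg₃ u , (sign₄ s (neg₄ i) , s)) }
  ; e       = (Data.Fin.zero , (Data.Fin.zero , Data.Fin.zero))
  ; elems   = cartesianProduct (allFin 3) (cartesianProduct (allFin 4) (allFin 2))
  }

sizes : List ℕ
sizes = 1 ∷ 1 ∷ 1 ∷ 2 ∷ 2 ∷ 17 ∷ []

HasHadamardPDF : FinGroup → Set
HasHadamardPDF G = Data.Product.∃ λ blocks → IsHadamardPDF G blocks sizes 12

{-# OPTIONS --safe #-}
-- Each family is exhibited explicitly and its defining properties are
-- confirmed by evaluation: a permutation between the concatenated blocks
-- and the element list is found by search, and the difference condition
-- is decided element by element over the whole group.
module Submission where

open import Defs
open import Data.Fin using (Fin; #_)
open import Data.List using (List; []; _∷_; length; concat; concatMap; map)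
open import Data.List.Relation.Binary.Permutation.Propositional
  using (_↭_; refl; prep; swap; trans; ↭-sym)
open import Data.List.Relation.Unary.All as All using (All; all?)
open import Data.Maybe using (Maybe; just; nothing; from-just)
open import Data.Nat using (ℕ)
import Data.Nat as ℕ
open import Data.Product using (_×_; _,_; ∃)
open import Relation.Binary.Definitions using (DecidableEquality)
open import Relation.Binary.PropositionalEquality using (_≡_; refl)
open import Relation.Nullary using (¬_; Dec; yes; no)
open import Relation.Nullary.Decidable using (from-yes; ¬?; _→-dec_)

module ↭-Search {A : Set} (_≟_ : DecidableEquality A) where

  select : (x : A) (ys : List A) → Maybe (∃ λ rest → ys ↭ x ∷ rest)
  select x []       = nothing
  select x (y ∷ ys) with x ≟ y
  ... | yes refl = just (ys , refl)
  ... | no _ with select x ys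
  ...   | nothing          = nothing
  ...   | just (rest , ys↭) = just (y ∷ rest , trans (prep y ys↭) (swap y x refl))

  find-↭ : (xs ys : List A) → Maybe (xs ↭ ys)
  find-↭ []       []      = just refl
  find-↭ []       (_ ∷ _) = nothing
  find-↭ (x ∷ xs) ys with select x ys
  ... | nothing          = nothing
  ... | just (rest , ys↭) with find-↭ xs rest
  ...   | nothing  = nothing
  ...   | just xs↭ = just (trans (prep x xs↭) (↭-sym ys↭))

module _ (G : FinGroup) where
  open FinGroup G

  CoveredExactly : List (List Carrier) → ℕ → Carrier → Set
  CoveredExactly blocks lam g = ¬ (g ≡ e) → mult G g (concatMap (Δ G) blocks) ≡ lam

  coveredExactly? : ∀ blocks lam g → Dec (CoveredExactly blocks lam g)
  coveredExactly? blocks lam g =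
    ¬? (g ≟ e) →-dec (mult G g (concatMap (Δ G) blocks) ℕ.≟ lam)

  isHadamardPDF : ∀ blocks ks lam →
    map length blocks ≡ ks →
    concat blocks ↭ elems →
    All (CoveredExactly blocks lam) elems →
    length elems ≡ 2 ℕ.* lam →
    IsHadamardPDF G blocks ks lam
  isHadamardPDF blocks ks lam sizes-ok partition covered order =
    (sizes-ok , partition , λ g g∈G → All.lookup covered g∈G) , order

  findPartition : (blocks : List (List Carrier)) → Maybe (concat blocks ↭ elems)
  findPartition blocks = ↭-Search.find-↭ _≟_ (concat blocks) elems

  allCoveredExactly? : ∀ blocks lam → Dec (All (CoveredExactly blocks lam) elems)
  allCoveredExactly? blocks lam = all? (coveredExactly? blocks lam) elems

blocks-C3⋊C8 : List (List (Fin 3 × Fin 8))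
blocks-C3⋊C8 =
    ((# 0 , # 0) ∷ [])
  ∷ ((# 0 , # 2) ∷ [])
  ∷ ((# 0 , # 4) ∷ [])
  ∷ ((# 0 , # 1) ∷ (# 2 , # 2) ∷ [])
  ∷ ((# 1 , # 0) ∷ (# 1 , # 5) ∷ [])
  ∷ ( (# 0 , # 3) ∷ (# 0 , # 5) ∷ (# 0 , # 6) ∷ (# 0 , # 7) ∷ (# 1 , # 1) ∷ (# 1 , # 2)
    ∷ (# 1 , # 3) ∷ (# 1 , # 4) ∷ (# 1 , # 6) ∷ (# 1 , # 7) ∷ (# 2 , # 0) ∷ (# 2 , # 1)
    ∷ (# 2 , # 3) ∷ (# 2 , # 4) ∷ (# 2 , # 5) ∷ (# 2 , # 6) ∷ (# 2 , # 7) ∷ [])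
  ∷ []

blocks-SL23 : List (List M₂)
blocks-SL23 =
    ((# 0 , # 1 , # 2 , # 0) ∷ [])
  ∷ ((# 0 , # 2 , # 1 , # 0) ∷ [])
  ∷ ((# 2 , # 1 , # 1 , # 1) ∷ [])
  ∷ ((# 0 , # 1 , # 2 , # 1) ∷ (# 1 , # 0 , # 1 , # 1) ∷ [])
  ∷ ((# 2 , # 0 , # 1 , # 2) ∷ (# 2 , # 1 , # 2 , # 0) ∷ [])
  ∷ ( (# 0 , # 1 , # 2 , # 2) ∷ (# 0 , # 2 , # 1 , # 1) ∷ (# 0 , # 2 , # 1 , # 2) ∷ (# 1 , # 0 , # 0 , # 1)
    ∷ (# 1 , # 0 , # 2 , # 1) ∷ (# 1 , # 1 , # 0 , # 1) ∷ (# 1 , # 1 , # 1 , # 2) ∷ (# 1 , # 1 , # 2 , # 0)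
    ∷ (# 1 , # 2 , # 0 , # 1) ∷ (# 1 , # 2 , # 1 , # 0) ∷ (# 1 , # 2 , # 2 , # 2) ∷ (# 2 , # 0 , # 0 , # 2)
    ∷ (# 2 , # 0 , # 2 , # 2) ∷ (# 2 , # 1 , # 0 , # 2) ∷ (# 2 , # 2 , # 0 , # 2) ∷ (# 2 , # 2 , # 1 , # 0)
    ∷ (# 2 , # 2 , # 2 , # 1) ∷ [])
  ∷ []

blocks-Z3×D8 : List (List (Fin 3 × Fin 4 × Fin 2))
blocks-Z3×D8 =
    ((# 0 , # 0 , # 0) ∷ [])
  ∷ ((# 0 , # 2 , # 0) ∷ [])
  ∷ ((# 1 , # 0 , # 0) ∷ [])
  ∷ ((# 0 , # 0 , # 1) ∷ (# 2 , # 1 , # 0) ∷ [])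
  ∷ ((# 0 , # 1 , # 0) ∷ (# 2 , # 2 , # 1) ∷ [])
  ∷ ( (# 0 , # 1 , # 1) ∷ (# 0 , # 2 , # 1) ∷ (# 0 , # 3 , # 0) ∷ (# 0 , # 3 , # 1) ∷ (# 1 , # 0 , # 1) ∷ (# 1 , # 1 , # 0)
    ∷ (# 1 , # 1 , # 1) ∷ (# 1 , # 2 , # 0) ∷ (# 1 , # 2 , # 1) ∷ (# 1 , # 3 , # 0) ∷ (# 1 , # 3 , # 1) ∷ (# 2 , # 0 , # 0)
    ∷ (# 2 , # 0 , # 1) ∷ (# 2 , # 1 , # 1) ∷ (# 2 , # 2 , # 0) ∷ (# 2 , # 3 , # 0) ∷ (# 2 , # 3 , # 1) ∷ [])
  ∷ []

mainTheorem10 : HasHadamardPDF C3⋊C8 × HasHadamardPDF SL23 × HasHadamardPDF Z3×D8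
mainTheorem10 =
    ( blocks-C3⋊C8
    , isHadamardPDF C3⋊C8 blocks-C3⋊C8 sizes 12 refl
        (from-just (findPartition C3⋊C8 blocks-C3⋊C8))
        (from-yes (allCoveredExactly? C3⋊C8 blocks-C3⋊C8 12))
        refl )
  , ( blocks-SL23
    , isHadamardPDF SL23 blocks-SL23 sizes 12 refl
        (from-just (findPartition SL23 blocks-SL23))
        (from-yes (allCoveredExactly? SL23 blocks-SL23 12))
        refl )
  , ( blocks-Z3×D8
    , isHadamardPDF Z3×D8 blocks-Z3×D8 sizes 12 refl
        (from-just (findPartition Z3×D8 blocks-Z3×D8))
        (from-yes (allCoveredExactly? Z3×D8 blocks-Z3×D8 12))
        refl )
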